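{- Let $G$ be a graph with no induced $P_7$, $C_4$, $C_6$ or $C_7$, let $H=(B_1,\dots,B_5)$ be a nice blowup of $C_5$ in $G$, and let $x,y\in A'_3(i)$ be non-adjacent. Then for one $j\in\{i-1,i+1\}$ we have $N(x)\cap B_j\subseteq N(y)\cap B_j$ or $N(y)\cap B_j\subseteq N(x)\cap B_j$, and for the other $j'\in\{i-1,i+1\}$ we have $N(x)\cap N(y)\cap B_{j'}=\emptyset$.
   Context: Indices are modulo $5$. A tuple $(B_1,\dots,B_5)$ of pairwise disjoint nonempty vertex sets is a nice blowup of $C_5$ in $G$ if: each $B_i$ is a clique; every $v\in B_i$ has a neighbor in $B_{i-1}$ and in $B_{i+1}$; there are no edges between $B_i$ and $B_{i+2}$; and for every $i$, $a\in B_i$, distinct $b,c\in B_{i+1}$, $d\in B_{i+2}$, $G[\{a,b,c,d\}]$ is not an induced $P_4$. For $v\notin V(H)=\bigcup B_j$, $\mathrm{supp}(v)=\{j:N(v)\cap B_j\ne\emptyset\}$; $A_3(i)$ is the set of $v\notin V(H)$ with $\mathrm{supp}(v)=\{i-1,i,i+1\}$, and $A'_3(i)=A_3(i)\cup B_i$. -}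

module Defs where

open import Data.Nat using (ℕ; zero; suc; _≡ᵇ_)
open import Data.Fin using (Fin; zero; suc; toℕ)
open import Data.Bool using (Bool; true; false; _∨_; _∧_)
open import Data.Product using (Σ; _×_; ∃; ∃-syntax)
open import Data.Sum using (_⊎_)
open import Data.Empty using (⊥)
open import Relation.Nullary using (¬_)
open import Relation.Binary.PropositionalEquality using (_≡_; _≢_)
open import Function using (_∘_)
open import Function.Definitions using (Injective)

record Graph : Set where
  field
    n      : ℕ
    E      : Fin n → Fin n → Bool
    sym    : ∀ u v → E u v ≡ E v u
    irrefl : ∀ u → E u u ≡ false

module _ (G : Graph) where
  open Graph G

  V : Set
  V = Fin n

  Adj : V → V → Set
  Adj u v = E u v ≡ true

  IsInducedEmbedding : {k : ℕ} → (Fin k → Fin k → Bool) → (Fin k → V) → Set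
  IsInducedEmbedding F f =
    Injective _≡_ _≡_ f × (∀ a b → a ≢ b → E (f a) (f b) ≡ F a b)

  HasInduced : {k : ℕ} → (Fin k → Fin k → Bool) → Set
  HasInduced {k} F = Σ (Fin k → V) (IsInducedEmbedding F)

pathE : {k : ℕ} → Fin k → Fin k → Bool
pathE a b = (suc (toℕ a) ≡ᵇ toℕ b) ∨ (suc (toℕ b) ≡ᵇ toℕ a)

cycleE : {k : ℕ} → Fin k → Fin k → Bool
cycleE {k} a b = pathE a b
  ∨ ((toℕ a ≡ᵇ 0) ∧ (suc (toℕ b) ≡ᵇ k))
  ∨ ((toℕ b ≡ᵇ 0) ∧ (suc (toℕ a) ≡ᵇ k))

P : (k : ℕ) → Fin k → Fin k → Bool
P k = pathE {k}

C : (k : ℕ) → Fin k → Fin k → Bool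
C k = cycleE {k}

next : Fin 5 → Fin 5
next zero = suc zero
next (suc zero) = suc (suc zero)
next (suc (suc zero)) = suc (suc (suc zero))
next (suc (suc (suc zero))) = suc (suc (suc (suc zero)))
next (suc (suc (suc (suc zero)))) = zero

prev : Fin 5 → Fin 5
prev zero = suc (suc (suc (suc zero)))
prev (suc zero) = zero
prev (suc (suc zero)) = suc zero
prev (suc (suc (suc zero))) = suc (suc zero)
prev (suc (suc (suc (suc zero)))) = suc (suc (suc zero))

module _ (G : Graph) where
  open Graph G

  -- a 5-tuple of vertex sets (B i v = true iff v ∈ B_i)
  Blowup : Set
  Blowup = Fin 5 → Fin n → Bool

  -- G[{a,b,c,d}] is an induced P4: some ordering of a,b,c,d is an induced path
  InducedP4On : V G → V G → V G → V G → Set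
  InducedP4On a b c d = Σ (Fin 4 → Fin 4) λ π → IsInducedEmbedding G (P 4) (g ∘ π)
    where
    g : Fin 4 → V G
    g zero = a
    g (suc zero) = b
    g (suc (suc zero)) = c
    g (suc (suc (suc zero))) = d

  record IsNiceBlowup (B : Blowup) : Set where
    field
      disjoint  : ∀ i j v → i ≢ j → B i v ≡ true → B j v ≡ false
      nonempty  : ∀ i → ∃[ v ] (B i v ≡ true)
      clique    : ∀ i u v → B i u ≡ true → B i v ≡ true → u ≢ v → Adj G u v
      nbrPrev   : ∀ i v → B i v ≡ true → ∃[ u ] (B (prev i) u ≡ true × Adj G v u)
      nbrNext   : ∀ i v → B i v ≡ true → ∃[ u ] (B (next i) u ≡ true × Adj G v u)
      noEdges   : ∀ i u v → B i u ≡ true → B (next (next i)) v ≡ true → ¬ Adj G u v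
      noP4      : ∀ i a b c d → B i a ≡ true → B (next i) b ≡ true → B (next i) c ≡ true
                  → b ≢ c → B (next (next i)) d ≡ true → ¬ InducedP4On a b c d

  module _ (B : Blowup) where
    InH : V G → Set
    InH v = ∃[ j ] (B j v ≡ true)

    InSupp : V G → Fin 5 → Set
    InSupp v j = ∃[ u ] (B j u ≡ true × Adj G v u)

    A3 : Fin 5 → V G → Set
    A3 i v = ¬ InH v
      × (∀ j → InSupp v j → (j ≡ prev i ⊎ j ≡ i ⊎ j ≡ next i))
      × InSupp v (prev i) × InSupp v i × InSupp v (next i)

    A3' : Fin 5 → V G → Set
    A3' i v = A3 i v ⊎ B i v ≡ true

    NbrSub : V G → V G → Fin 5 → Set
    NbrSub x y j = ∀ u → B j u ≡ true → Adj G x u → Adj G y u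

    NoCommonNbr : V G → V G → Fin 5 → Set
    NoCommonNbr x y j = ∀ u → B j u ≡ true → Adj G x u → Adj G y u → ⊥

    Comparable : V G → V G → Fin 5 → Set
    Comparable x y j = NbrSub x y j ⊎ NbrSub y x j

{-# OPTIONS --safe #-}
module Submission where

-- If x and y had common neighbours c ∈ B(i+1) and d ∈ B(i−1), then x c y d
-- would be an induced C₄, since B(i−1) and B(i+1) are disjoint and anticomplete.
-- So on some side j ∈ {i−1, i+1} the neighbourhoods of x and y in B j are
-- disjoint, and both are nonempty because x, y ∈ A'₃(i). If on the other side j′
-- neither neighbourhood contained the other, private neighbours a of x and a′ of y
-- in B j′, together with neighbours b of x and b′ of y in B j, would form an
-- induced C₆  x a a′ y b′ b,  the classes being cliques.

open import Defs
open import Data.Bool using (Bool; true; false; _∨_; _∧_)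
open import Data.Bool.Properties using (∨-comm; ¬-not) renaming (_≟_ to _≟ᵇ_)
open import Data.Empty using (⊥; ⊥-elim)
open import Data.Fin using (Fin; zero; suc; _<_; toℕ)
open import Data.Fin.Properties using (<-cmp; all?; any?) renaming (_≟_ to _≟ᶠ_)
open import Data.List using (tabulate; allFin)
open import Data.List.Relation.Unary.All using ([]; _∷_)
import Data.List.Relation.Unary.All.Properties as All
open import Data.List.Relation.Unary.AllPairs using (AllPairs; []; _∷_)
open import Data.List.Relation.Unary.Unique.Propositional using (Unique)
open import Data.Nat using (suc; s<s; _≡ᵇ_)
open import Data.Product using (_×_; _,_; ∃-syntax)
open import Data.Sum using (_⊎_; inj₁; inj₂)
open import Data.Vec using (lookup; _∷_; [])
open import Function.Definitions using (Injective)
open import Relation.Binary using (Rel; tri<; tri≈; tri>)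
open import Relation.Binary.PropositionalEquality
  using (_≡_; _≢_; refl; sym; trans; cong; cong₂; subst; module ≡-Reasoning)
open import Relation.Nullary using (¬_; yes; no; Dec; ¬?)
open import Relation.Nullary.Decidable using (_×-dec_; _→-dec_; from-yes)

allPairs-tabulate⁻ : ∀ {a ℓ} {A : Set a} {R : Rel A ℓ} {k} {f : Fin k → A} →
                     AllPairs R (tabulate f) → ∀ {i j} → i < j → R (f i) (f j)
allPairs-tabulate⁻ (Rf₀ ∷ _)  {zero}  {suc j} _         = All.tabulate⁻ Rf₀ j
allPairs-tabulate⁻ (_ ∷ Rfₛ) {suc i} {suc j} (s<s i<j) = allPairs-tabulate⁻ Rfₛ i<j

unique-tabulate⇒injective : ∀ {a} {A : Set a} {k} {f : Fin k → A} →
                            Unique (tabulate f) → Injective _≡_ _≡_ f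
unique-tabulate⇒injective f! {i} {j} fi≡fj with <-cmp i j
... | tri< i<j _ _ = ⊥-elim (allPairs-tabulate⁻ f! i<j fi≡fj)
... | tri≈ _ i≡j _ = i≡j
... | tri> _ _ j<i = ⊥-elim (allPairs-tabulate⁻ f! j<i (sym fi≡fj))

TwinFree : ∀ {k} → (Fin k → Fin k → Bool) → Set
TwinFree F = ∀ a b → (∀ c → F c a ≡ F c b) → a ≡ b

twinFree? : ∀ {k} (F : Fin k → Fin k → Bool) → Dec (TwinFree F)
twinFree? F = all? λ a → all? λ b → all? (λ c → F c a ≟ᵇ F c b) →-dec a ≟ᶠ b

C-sym : ∀ k a b → C k a b ≡ C k b a
C-sym k a b = cong₂ _∨_ (∨-comm (suc (toℕ a) ≡ᵇ toℕ b) _)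
                        (∨-comm ((toℕ a ≡ᵇ 0) ∧ (suc (toℕ b) ≡ᵇ k)) _)

C6-irreflexive : ∀ a → C 6 a a ≡ false
C6-irreflexive = from-yes (all? λ a → C 6 a a ≟ᵇ false)

C6-twinFree : TwinFree (C 6)
C6-twinFree = from-yes (twinFree? (C 6))

module _ (G : Graph) where
  open Graph G renaming (sym to E-sym)

  Matches : ∀ {k} → (Fin k → Fin k → Bool) → (Fin k → V G) → Set
  Matches F f = ∀ a b → a ≢ b → E (f a) (f b) ≡ F a b

  Adj-sym : ∀ {u v} → Adj G u v → Adj G v u
  Adj-sym {u} {v} uv = trans (E-sym v u) uv

  ≁-sym : ∀ {u v} → ¬ Adj G u v → ¬ Adj G v u
  ≁-sym u≁v vu = u≁v (Adj-sym vu)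

  adj⇒≢ : ∀ {u v} → Adj G u v → u ≢ v
  adj⇒≢ {u} uv refl with trans (sym uv) (irrefl u)
  ... | ()

  matches-from-upper : ∀ {k} {F : Fin k → Fin k → Bool} {f : Fin k → V G} →
                       (∀ a b → F a b ≡ F b a) →
                       AllPairs (λ a b → E (f a) (f b) ≡ F a b) (allFin k) → Matches F f
  matches-from-upper {f = f} F-sym upper a b a≢b with <-cmp a b
  ... | tri< a<b _ _ = allPairs-tabulate⁻ upper a<b
  ... | tri≈ _ a≡b _ = ⊥-elim (a≢b a≡b)
  ... | tri> _ _ b<a = trans (E-sym (f a) (f b)) (trans (allPairs-tabulate⁻ upper b<a) (F-sym b a))

  twinFree⇒injective : ∀ {k} {F : Fin k → Fin k → Bool} {f : Fin k → V G} →
                       (∀ a → F a a ≡ false) → TwinFree F → Matches F f → Injective _≡_ _≡_ f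
  twinFree⇒injective {F = F} {f} F-irrefl twinFree matches {a} {b} fa≡fb = twinFree a b same-column
    where
    matches-everywhere : ∀ c d → E (f c) (f d) ≡ F c d
    matches-everywhere c d with c ≟ᶠ d
    ... | yes refl = trans (irrefl (f c)) (sym (F-irrefl c))
    ... | no c≢d   = matches c d c≢d

    open ≡-Reasoning
    same-column : ∀ c → F c a ≡ F c b
    same-column c = begin
      F c a         ≡⟨ sym (matches-everywhere c a) ⟩
      E (f c) (f a) ≡⟨ cong (E (f c)) fa≡fb ⟩
      E (f c) (f b) ≡⟨ matches-everywhere c b ⟩
      F c b         ∎

  -- Opposite vertices of C₄ are twins, so their distinctness must be supplied.
  induced-C4 : ∀ {v₀ v₁ v₂ v₃} →
               Adj G v₀ v₁ → Adj G v₁ v₂ → Adj G v₂ v₃ → Adj G v₀ v₃ →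
               ¬ Adj G v₀ v₂ → ¬ Adj G v₁ v₃ → v₀ ≢ v₂ → v₁ ≢ v₃ →
               HasInduced G (C 4)
  induced-C4 {v₀} {v₁} {v₂} {v₃} e₀₁ e₁₂ e₂₃ e₀₃ n₀₂ n₁₃ v₀≢v₂ v₁≢v₃ =
    f , unique-tabulate⇒injective distinct , matches-from-upper (C-sym 4) upper
    where
    f : Fin 4 → V G
    f = lookup (v₀ ∷ v₁ ∷ v₂ ∷ v₃ ∷ [])

    distinct : Unique (tabulate f)
    distinct = (adj⇒≢ e₀₁ ∷ v₀≢v₂ ∷ adj⇒≢ e₀₃ ∷ [])
             ∷ (adj⇒≢ e₁₂ ∷ v₁≢v₃ ∷ [])
             ∷ (adj⇒≢ e₂₃ ∷ [])
             ∷ [] ∷ []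

    upper : AllPairs (λ a b → E (f a) (f b) ≡ C 4 a b) (allFin 4)
    upper = (e₀₁ ∷ ¬-not n₀₂ ∷ e₀₃ ∷ [])
          ∷ (e₁₂ ∷ ¬-not n₁₃ ∷ [])
          ∷ (e₂₃ ∷ [])
          ∷ [] ∷ []

  induced-C6 : ∀ {v₀ v₁ v₂ v₃ v₄ v₅} →
               Adj G v₀ v₁ → Adj G v₁ v₂ → Adj G v₂ v₃ → Adj G v₃ v₄ → Adj G v₄ v₅ → Adj G v₀ v₅ →
               ¬ Adj G v₀ v₂ → ¬ Adj G v₀ v₃ → ¬ Adj G v₀ v₄ →
               ¬ Adj G v₁ v₃ → ¬ Adj G v₁ v₄ → ¬ Adj G v₁ v₅ →
               ¬ Adj G v₂ v₄ → ¬ Adj G v₂ v₅ → ¬ Adj G v₃ v₅ →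
               HasInduced G (C 6)
  induced-C6 {v₀} {v₁} {v₂} {v₃} {v₄} {v₅}
             e₀₁ e₁₂ e₂₃ e₃₄ e₄₅ e₀₅ n₀₂ n₀₃ n₀₄ n₁₃ n₁₄ n₁₅ n₂₄ n₂₅ n₃₅ =
    f , twinFree⇒injective C6-irreflexive C6-twinFree matches , matches
    where
    f : Fin 6 → V G
    f = lookup (v₀ ∷ v₁ ∷ v₂ ∷ v₃ ∷ v₄ ∷ v₅ ∷ [])

    matches : Matches (C 6) f
    matches = matches-from-upper (C-sym 6)
      ( (e₀₁ ∷ ¬-not n₀₂ ∷ ¬-not n₀₃ ∷ ¬-not n₀₄ ∷ e₀₅ ∷ [])
      ∷ (e₁₂ ∷ ¬-not n₁₃ ∷ ¬-not n₁₄ ∷ ¬-not n₁₅ ∷ [])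
      ∷ (e₂₃ ∷ ¬-not n₂₄ ∷ ¬-not n₂₅ ∷ [])
      ∷ (e₃₄ ∷ ¬-not n₃₅ ∷ [])
      ∷ (e₄₅ ∷ [])
      ∷ [] ∷ [])

  C4-free⇒common-neighbours-adjacent :
    ¬ HasInduced G (C 4) → ∀ {x y c d} → x ≢ y → ¬ Adj G x y → c ≢ d →
    Adj G x c → Adj G y c → Adj G x d → Adj G y d → Adj G c d
  C4-free⇒common-neighbours-adjacent noC4 {c = c} {d} x≢y x≁y c≢d xc yc xd yd
    with E c d ≟ᵇ true
  ... | yes cd  = cd
  ... | no c≁d = ⊥-elim (noC4 (induced-C4 xc (Adj-sym yc) yd xd x≁y c≁d x≢y c≢d))

  IsClique : (V G → Bool) → Set
  IsClique S = ∀ u v → S u ≡ true → S v ≡ true → u ≢ v → Adj G u v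

  Anticomplete : (V G → Bool) → (V G → Bool) → Set
  Anticomplete S T = ∀ u v → S u ≡ true → T v ≡ true → ¬ Adj G u v

  anticomplete-sym : ∀ {S T} → Anticomplete S T → Anticomplete T S
  anticomplete-sym S≁T u v u∈T v∈S = ≁-sym (S≁T v u v∈S u∈T)

  module _ (B : Blowup G) where

    PrivateNbr : V G → V G → Fin 5 → Set
    PrivateNbr x y j = ∃[ a ] (B j a ≡ true × Adj G x a × ¬ Adj G y a)

    CommonNbr : V G → V G → Fin 5 → Set
    CommonNbr x y j = ∃[ a ] (B j a ≡ true × Adj G x a × Adj G y a)

    privateNbr? : ∀ x y j → Dec (PrivateNbr x y j)
    privateNbr? x y j = any? λ a → B j a ≟ᵇ true ×-dec E x a ≟ᵇ true ×-dec ¬? (E y a ≟ᵇ true)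

    no-privateNbr⇒nbrSub : ∀ {x y j} → ¬ PrivateNbr x y j → NbrSub G B x y j
    no-privateNbr⇒nbrSub {y = y} none a a∈ xa with E y a ≟ᵇ true
    ... | yes ya  = ya
    ... | no y≁a = ⊥-elim (none (a , a∈ , xa , y≁a))

    comparable-or-privateNbrs : ∀ x y j →
      Comparable G B x y j ⊎ (PrivateNbr x y j × PrivateNbr y x j)
    comparable-or-privateNbrs x y j with privateNbr? x y j | privateNbr? y x j
    ... | no none   | _          = inj₁ (inj₁ (no-privateNbr⇒nbrSub none))
    ... | yes _     | no none    = inj₁ (inj₂ (no-privateNbr⇒nbrSub none))
    ... | yes xOnly | yes yOnly  = inj₂ (xOnly , yOnly)

    noCommonNbr-or-commonNbr : ∀ x y j → NoCommonNbr G B x y j ⊎ CommonNbr x y j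
    noCommonNbr-or-commonNbr x y j
      with any? (λ a → B j a ≟ᵇ true ×-dec E x a ≟ᵇ true ×-dec E y a ≟ᵇ true)
    ... | yes common = inj₂ common
    ... | no none    = inj₁ λ a a∈ xa ya → none (a , a∈ , xa , ya)

    C6-free⇒comparable :
      ¬ HasInduced G (C 6) → ∀ {p q x y} →
      IsClique (B p) → IsClique (B q) → Anticomplete (B p) (B q) → ¬ Adj G x y →
      InSupp G B x q → InSupp G B y q → NoCommonNbr G B x y q → Comparable G B x y p
    C6-free⇒comparable noC6 {p} {q} {x} {y} p-clique q-clique p≁q x≁y
                       (b , b∈ , xb) (b′ , b′∈ , yb′) none
      with comparable-or-privateNbrs x y p
    ... | inj₁ comparable = comparable
    ... | inj₂ ((a , a∈ , xa , y≁a) , (a′ , a′∈ , ya′ , x≁a′)) =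
      ⊥-elim (noC6 (induced-C6
        xa (p-clique a a′ a∈ a′∈ a≢a′) (Adj-sym ya′) yb′ (q-clique b′ b b′∈ b∈ b′≢b) xb
        x≁a′ x≁y x≁b′
        (≁-sym y≁a) (p≁q a b′ a∈ b′∈) (p≁q a b a∈ b∈)
        (p≁q a′ b′ a′∈ b′∈) (p≁q a′ b a′∈ b∈) y≁b))
      where
      x≁b′ : ¬ Adj G x b′
      x≁b′ xb′ = none b′ b′∈ xb′ yb′
      y≁b : ¬ Adj G y b
      y≁b yb = none b b∈ xb yb
      a≢a′ : a ≢ a′
      a≢a′ refl = x≁a′ xa
      b′≢b : b′ ≢ b
      b′≢b refl = y≁b yb′

next∘next∘prev : ∀ i → next (next (prev i)) ≡ next i
next∘next∘prev zero                         = refl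
next∘next∘prev (suc zero)                   = refl
next∘next∘prev (suc (suc zero))             = refl
next∘next∘prev (suc (suc (suc zero)))       = refl
next∘next∘prev (suc (suc (suc (suc zero)))) = refl

next≢prev : ∀ i → next i ≢ prev i
next≢prev zero                         ()
next≢prev (suc zero)                   ()
next≢prev (suc (suc zero))             ()
next≢prev (suc (suc (suc zero)))       ()
next≢prev (suc (suc (suc (suc zero)))) ()

module _ {G : Graph} {B : Blowup G} (nice : IsNiceBlowup G B) where
  open IsNiceBlowup nice

  prev-next-anticomplete : ∀ i → Anticomplete G (B (prev i)) (B (next i))
  prev-next-anticomplete i u v u∈ v∈ =
    noEdges (prev i) u v u∈ (subst (λ j → B j v ≡ true) (sym (next∘next∘prev i)) v∈)

  next-prev-disjoint : ∀ i {v} → B (next i) v ≡ true → B (prev i) v ≡ true → ⊥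
  next-prev-disjoint i {v} v∈next v∈prev
    with trans (sym (disjoint (next i) (prev i) v (next≢prev i) v∈next)) v∈prev
  ... | ()

  A3'-inSupp-prev : ∀ {i v} → A3' G B i v → InSupp G B v (prev i)
  A3'-inSupp-prev (inj₁ (_ , _ , supp , _ , _)) = supp
  A3'-inSupp-prev {i} {v} (inj₂ v∈) = nbrPrev i v v∈

  A3'-inSupp-next : ∀ {i v} → A3' G B i v → InSupp G B v (next i)
  A3'-inSupp-next (inj₁ (_ , _ , _ , _ , supp)) = supp
  A3'-inSupp-next {i} {v} (inj₂ v∈) = nbrNext i v v∈

  comparable-prev : ¬ HasInduced G (C 6) → ∀ {i x y} → A3' G B i x → A3' G B i y →
                    ¬ Adj G x y → NoCommonNbr G B x y (next i) → Comparable G B x y (prev i)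
  comparable-prev noC6 {i} x∈ y∈ x≁y =
    C6-free⇒comparable G B noC6 (clique (prev i)) (clique (next i))
      (prev-next-anticomplete i) x≁y (A3'-inSupp-next x∈) (A3'-inSupp-next y∈)

  comparable-next : ¬ HasInduced G (C 6) → ∀ {i x y} → A3' G B i x → A3' G B i y →
                    ¬ Adj G x y → NoCommonNbr G B x y (prev i) → Comparable G B x y (next i)
  comparable-next noC6 {i} x∈ y∈ x≁y =
    C6-free⇒comparable G B noC6 (clique (next i)) (clique (prev i))
      (anticomplete-sym G (prev-next-anticomplete i)) x≁y (A3'-inSupp-prev x∈) (A3'-inSupp-prev y∈)

lemma4p12 : (G : Graph)
    → ¬ HasInduced G (P 7) → ¬ HasInduced G (C 4) → ¬ HasInduced G (C 6) → ¬ HasInduced G (C 7)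
    → (B : Blowup G) → IsNiceBlowup G B
    → (i : Fin 5) (x y : V G)
    → A3' G B i x → A3' G B i y → x ≢ y → ¬ Adj G x y
    → (Comparable G B x y (prev i) × NoCommonNbr G B x y (next i))
      ⊎ (Comparable G B x y (next i) × NoCommonNbr G B x y (prev i))
lemma4p12 G _ noC4 noC6 _ B nice i x y x∈ y∈ x≢y x≁y
  with noCommonNbr-or-commonNbr G B x y (next i) | noCommonNbr-or-commonNbr G B x y (prev i)
... | inj₁ none | _ = inj₁ (comparable-prev nice noC6 x∈ y∈ x≁y none , none)
... | inj₂ _ | inj₁ none = inj₂ (comparable-next nice noC6 x∈ y∈ x≁y none , none)
... | inj₂ (c , c∈ , xc , yc) | inj₂ (d , d∈ , xd , yd) =
  ⊥-elim (prev-next-anticomplete nice i d c d∈ c∈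
    (C4-free⇒common-neighbours-adjacent G noC4 x≢y x≁y d≢c xd yd xc yc))
  where
  d≢c : d ≢ c
  d≢c refl = next-prev-disjoint nice i c∈ d∈
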